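{- For all $a,n\in\mathbb{N}$ there exists $n'\in\mathbb{N}$ such that the following holds. Let $G$ and $H$ be graphs and let $(A_x:x\in V(H))$ be an $H$-partition of $G$ with $|A_x|\le a$ for all $x\in V(H)$, and let $w\in V(H)$. If $G$ contains a path on $n'$ vertices, then $H-w$ contains a path on $n$ vertices.
   Context: Graphs are finite and simple. A partition $\mathcal{P}$ of $G$ is a set of pairwise disjoint sets (parts) covering $V(G)$; its quotient $G/\mathcal{P}$ has vertex set $\mathcal{P}$, distinct parts adjacent iff some vertex of one is adjacent in $G$ to some vertex of the other. An $H$-partition of $G$ is a partition $(A_x:x\in V(H))$ indexed by $V(H)$ whose quotient is $H$ (i.e. $A_x$ and $A_y$ are joined by an edge of $G$ iff $xy\in E(H)$). -}

module Defs where

open import Data.Nat using (ℕ; suc; _≤_)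
open import Data.Fin using (Fin; toℕ)
open import Data.Fin.Properties using () renaming (_≟_ to _≟ᶠ_)
open import Data.Bool using (Bool; true; false)
open import Data.List using (length; filter)
open import Data.List.Base using (allFin)
open import Data.Product using (Σ; ∃; _×_)
open import Relation.Binary.PropositionalEquality using (_≡_; _≢_)
open import Function.Bundles using (_⇔_)
open import Function.Definitions using (Injective)

record Graph : Set where
  field
    order : ℕ
    adj   : Fin order → Fin order → Bool
    sym   : ∀ u v → adj u v ≡ adj v u
    irrefl : ∀ u → adj u u ≡ false

open Graph public

V : Graph → Set
V G = Fin (order G)

Adj : (G : Graph) → V G → V G → Set
Adj G u v = adj G u v ≡ true

IsPath : (G : Graph) (n : ℕ) → (Fin n → V G) → Set
IsPath G n p = Injective _≡_ _≡_ p ×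
  (∀ (i j : Fin n) → toℕ j ≡ suc (toℕ i) → Adj G (p i) (p j))

HasPath : Graph → ℕ → Set
HasPath G n = Σ (Fin n → V G) (IsPath G n)

HasPathAvoiding : (H : Graph) → V H → ℕ → Set
HasPathAvoiding H w n =
  Σ (Fin n → V H) λ p → IsPath H n p × (∀ i → p i ≢ w)

-- An H-partition (A_x : x ∈ V(H)) of G, encoded by the map f sending each
-- vertex of G to the index of its part (A_x = f⁻¹(x)); the quotient is H:
-- distinct x, y are adjacent in H iff some edge of G joins A_x and A_y.
IsHPartition : (G H : Graph) → (V G → V H) → Set
IsHPartition G H f = ∀ (x y : V H) → x ≢ y →
  (Adj H x y ⇔ ∃ λ u → ∃ λ v → f u ≡ x × f v ≡ y × Adj G u v)

partSize : (G H : Graph) → (V G → V H) → V H → ℕ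
partSize G H f x = length (filter (λ u → f u ≟ᶠ x) (allFin (order G)))

-- Deleting the at most a vertices of A_w from a path of G leaves at most a + 1 segments, so one
-- of them is long, and the parts it meets avoid w.  Along a walk of G meeting every part at most
-- a times, an H-path is grown from the part x of the first vertex: deleting the vertices of A_x
-- leaves a long segment directly preceded by a vertex of A_x, so the part of its first vertex is
-- adjacent to x in H.  Recursing inside that segment, which misses A_x, never revisits x.  Each
-- step costs a factor a + 1 in length (walkBound).
module Submission where

open import Defs
open import Level using (Level; _⊔_)
open import Data.Nat using (ℕ; zero; suc; _+_; _*_; _≤_; _<_; z≤n; s≤s)
open import Data.Nat.Properties
  using (≤-trans; ≤-reflexive; ≤-pred; suc-injective; _<?_; ≮⇒≥; +-suc; +-cancelˡ-≤; +-monoˡ-≤; m≤m+n;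
         module ≤-Reasoning)
open import Data.Fin using (Fin; toℕ) renaming (zero to fzero; suc to fsuc)
open import Data.Fin.Properties using (_≟_)
open import Data.List.Base using (List; []; _∷_; _++_; [_]; length; filter; map; lookup; tabulate)
open import Data.List.Properties
  using (length-++; length-++-sucʳ; ++-assoc; ++-identityʳ; filter-++; filter-none; filter-accept; length-tabulate)
open import Data.List.Membership.Propositional.Properties
  using (∈-allFin; ∈-lookup; ∈-∃++; ∈-++⁻; ∈-++⁺ˡ; ∈-++⁺ʳ)
open import Data.List.Relation.Unary.All as All using (All; []; _∷_)
open import Data.List.Relation.Unary.All.Properties using () renaming (map⁺ to All-map⁺)
open import Data.List.Relation.Unary.Any using (here; there)
open import Data.List.Relation.Unary.First as First using (FirstView; first)
open import Data.List.Relation.Unary.First.Properties using (toView)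
open import Data.List.Relation.Unary.Linked as Linked using (Linked; []; [-]; _∷_)
open import Data.List.Relation.Unary.Unique.Propositional using (Unique)
open import Data.List.Relation.Unary.AllPairs using ([]; _∷_)
import Data.List.Relation.Unary.Unique.Propositional.Properties as Unique
open import Data.List.Relation.Binary.Subset.Propositional using (_⊆_)
open import Data.List.Relation.Binary.Sublist.Propositional using () renaming (_⊆_ to _⊑_)
import Data.List.Relation.Binary.Sublist.Propositional as Sublist
import Data.List.Relation.Binary.Sublist.Propositional.Properties as Sublist
open import Data.List.Relation.Binary.Subset.Propositional.Properties
  using (⊆-trans; map⁺; ∈-∷⁺ʳ; All-resp-⊇; filter⁺′)
open import Data.Product using (Σ; ∃; _×_; _,_)
open import Data.Sum as Sum using (_⊎_; inj₁; inj₂)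
open import Data.Empty using (⊥-elim)
open import Function.Bundles using (Equivalence)
open import Function.Base using (id)
open import Relation.Binary.Core using (Rel)
open import Relation.Nullary.Decidable using (toSum; yes; no)
open import Relation.Unary using (Pred; Decidable; ∁)
open import Relation.Binary.PropositionalEquality
  using (_≡_; _≢_; refl; trans; cong; subst)
import Relation.Binary.PropositionalEquality as ≡

private
  variable
    a r : Level
    A : Set a

peel-block : ∀ c k {g r} → g ≤ k → suc c * suc k ≤ g + suc r → c * suc k ≤ r
peel-block c k {g} {r} g≤k le = +-cancelˡ-≤ (suc k) (c * suc k) r (begin
  suc k + c * suc k  ≤⟨ le ⟩
  g + suc r          ≤⟨ +-monoˡ-≤ (suc r) g≤k ⟩
  k + suc r          ≡⟨ +-suc k r ⟩
  suc k + r          ∎)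
  where open ≤-Reasoning

module _ {R : Rel A r} where

  Linked-++⁻ˡ : ∀ xs {ys} → Linked R (xs ++ ys) → Linked R xs
  Linked-++⁻ˡ []           _          = []
  Linked-++⁻ˡ (x ∷ [])     _          = [-]
  Linked-++⁻ˡ (x ∷ y ∷ xs) (Rxy ∷ rs) = Rxy ∷ Linked-++⁻ˡ (y ∷ xs) rs

  Linked-++⁻ʳ : ∀ xs {ys} → Linked R (xs ++ ys) → Linked R ys
  Linked-++⁻ʳ []       rs = rs
  Linked-++⁻ʳ (x ∷ xs) rs = Linked-++⁻ʳ xs (Linked.tail rs)

  Linked-infix : ∀ xs ys {zs} → Linked R (xs ++ ys ++ zs) → Linked R ys
  Linked-infix xs ys rs = Linked-++⁻ˡ ys (Linked-++⁻ʳ xs rs)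

  Linked-lookup : ∀ {xs} → Linked R xs → ∀ i j → toℕ j ≡ suc (toℕ i) → R (lookup xs i) (lookup xs j)
  Linked-lookup (Rxy ∷ _)  fzero    (fsuc fzero) _  = Rxy
  Linked-lookup (_   ∷ rs) (fsuc i) (fsuc j)     eq = Linked-lookup rs i j (suc-injective eq)
  Linked-lookup [-]        fzero    fzero        ()
  Linked-lookup (_ ∷ _)    fzero    fzero        ()
  Linked-lookup (_ ∷ _)    fzero    (fsuc (fsuc j)) ()
  Linked-lookup (_ ∷ _)    (fsuc i) fzero        ()

  Linked-tabulate : ∀ {n} {f : Fin n → A} → (∀ i j → toℕ j ≡ suc (toℕ i) → R (f i) (f j)) →
                    Linked R (tabulate f)
  Linked-tabulate {zero}        Rf = []
  Linked-tabulate {suc zero}    Rf = [-]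
  Linked-tabulate {suc (suc n)} Rf =
    Rf fzero (fsuc fzero) refl ∷ Linked-tabulate (λ i j eq → Rf (fsuc i) (fsuc j) (cong suc eq))

lookup-injective : ∀ {xs : List A} → Unique xs → ∀ {i j} → lookup xs i ≡ lookup xs j → i ≡ j
lookup-injective                 (_  ∷ _)  {fzero}  {fzero}  _  = refl
lookup-injective {xs = _ ∷ xs}   (x∉ ∷ _)  {fzero}  {fsuc j} eq = ⊥-elim (All.lookup x∉ (∈-lookup j) eq)
lookup-injective {xs = _ ∷ xs}   (x∉ ∷ _)  {fsuc i} {fzero}  eq = ⊥-elim (All.lookup x∉ (∈-lookup i) (≡.sym eq))
lookup-injective                 (_  ∷ xs!) {fsuc i} {fsuc j} eq = cong fsuc (lookup-injective xs! eq)

Unique-⊆⇒length-≤ : ∀ {xs ys : List A} → Unique xs → xs ⊆ ys → length xs ≤ length ys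
Unique-⊆⇒length-≤ {xs = []}     _          _  = z≤n
Unique-⊆⇒length-≤ {xs = x ∷ xs} (x∉ ∷ xs!) xs⊆ys with ∈-∃++ (xs⊆ys (here refl))
... | ys₁ , ys₂ , refl =
  subst (suc (length xs) ≤_) (≡.sym (length-++-sucʳ ys₁ x ys₂))
        (s≤s (Unique-⊆⇒length-≤ xs! xs⊆ys₁++ys₂))
  where
  xs⊆ys₁++ys₂ : xs ⊆ ys₁ ++ ys₂
  xs⊆ys₁++ys₂ {z} z∈xs with ∈-++⁻ ys₁ (xs⊆ys (there z∈xs))
  ... | inj₁ z∈ys₁           = ∈-++⁺ˡ z∈ys₁
  ... | inj₂ (here refl)     = ⊥-elim (All.lookup x∉ z∈xs refl)
  ... | inj₂ (there z∈ys₂)   = ∈-++⁺ʳ ys₁ z∈ys₂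

module _ {a p} {A : Set a} {P : Pred A p} (P? : Decidable P) where

  count : List A → ℕ
  count xs = length (filter P? xs)

  count-mono : ∀ {xs ys} → xs ⊑ ys → count xs ≤ count ys
  count-mono xs⊑ys = Sublist.length-mono-≤ (Sublist.filter⁺ P? P? (λ { refl → id }) xs⊑ys)

  count-accept : ∀ {x} xs → P x → count (x ∷ xs) ≡ suc (count xs)
  count-accept xs px = cong length (filter-accept P? px)

  count-none-++ : ∀ {xs} → All (∁ P) xs → ∀ ys → count (xs ++ ys) ≡ count ys
  count-none-++ {xs} none ys =
    cong length (trans (filter-++ P? xs ys) (cong (_++ filter P? ys) (filter-none P? none)))

  all-or-first : ∀ xs → All (∁ P) xs ⊎ FirstView (∁ P) P xs
  all-or-first xs = Sum.map₂ toView (Sum.swap (first (λ x → Sum.swap (toSum (P? x))) xs))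

  record Run (k : ℕ) (xs : List A) : Set (a ⊔ p) where
    field
      before segment after : List A
      split  : xs ≡ before ++ segment ++ after
      avoids : All (∁ P) segment
      long   : k < length segment

  record MarkedRun (k : ℕ) (xs : List A) : Set (a ⊔ p) where
    field
      before : List A
      marker : A
      segment after : List A
      split  : xs ≡ before ++ marker ∷ segment ++ after
      marked : P marker
      avoids : All (∁ P) segment
      long   : k < length segment

  MarkedRun-++ : ∀ {k xs} ys → MarkedRun k xs → MarkedRun k (ys ++ xs)
  MarkedRun-++ ys r = record
    { before  = ys ++ before
    ; marker  = marker
    ; segment = segment
    ; after   = after
    ; split   = trans (cong (ys ++_) split) (≡.sym (++-assoc ys before _))
    ; marked  = marked
    ; avoids  = avoids
    ; long    = long
    }
    where open MarkedRun r

  MarkedRun⇒Run : ∀ {k xs} → MarkedRun k xs → Run k xs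
  MarkedRun⇒Run r = record
    { before  = before ++ [ marker ]
    ; segment = segment
    ; after   = after
    ; split   = trans split (≡.sym (++-assoc before [ marker ] _))
    ; avoids  = avoids
    ; long    = long
    }
    where open MarkedRun r

  long-run-after : ∀ c {k y} t → P y → count (y ∷ t) ≤ c → c * suc k ≤ length t → MarkedRun k (y ∷ t)
  long-run-after zero t py cnt _ with () ← subst (_≤ 0) (count-accept t py) cnt
  long-run-after (suc c) {k} {y} t py cnt len with all-or-first t
  ... | inj₁ none = record
    { before = []; marker = y; segment = t; after = []
    ; split  = cong (y ∷_) (≡.sym (++-identityʳ t))
    ; marked = py; avoids = none
    ; long   = ≤-trans (m≤m+n (suc k) (c * suc k)) len
    }
  ... | inj₂ (First._++_∷_ {g} {y′} none py′ t′) with k <? length g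
  ...   | yes long = record
    { before = []; marker = y; segment = g; after = y′ ∷ t′
    ; split  = refl; marked = py; avoids = none; long = long
    }
  ...   | no short = MarkedRun-++ (y ∷ g) (long-run-after c t′ py′ cnt′ len′)
    where
    cnt′ : count (y′ ∷ t′) ≤ c
    cnt′ = ≤-pred (subst (_≤ suc c) count-y∷t cnt)
      where
      count-y∷t : count (y ∷ g ++ y′ ∷ t′) ≡ suc (count (y′ ∷ t′))
      count-y∷t = trans (count-accept (g ++ y′ ∷ t′) py) (cong suc (count-none-++ none (y′ ∷ t′)))
    len′ : c * suc k ≤ length t′
    len′ = peel-block c k (≮⇒≥ short) (subst (suc c * suc k ≤_) (length-++ g) len)

  long-run : ∀ c {k} xs → count xs ≤ c → suc c * suc k ≤ length xs → Run k xs
  long-run c {k} xs cnt len with all-or-first xs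
  ... | inj₁ none = record
    { before = []; segment = xs; after = []
    ; split  = ≡.sym (++-identityʳ xs)
    ; avoids = none
    ; long   = ≤-trans (m≤m+n (suc k) (c * suc k)) len
    }
  ... | inj₂ (First._++_∷_ {g} {y} none py r) with k <? length g
  ...   | yes long = record
    { before = []; segment = g; after = y ∷ r
    ; split  = refl; avoids = none; long = long
    }
  ...   | no short = MarkedRun⇒Run (MarkedRun-++ g (long-run-after c r py cnt′ len′))
    where
    cnt′ : count (y ∷ r) ≤ c
    cnt′ = subst (_≤ c) (count-none-++ none (y ∷ r)) cnt
    len′ : c * suc k ≤ length r
    len′ = peel-block c k (≮⇒≥ short) (subst (suc c * suc k ≤_) (length-++ g) len)

walkBound : ℕ → ℕ → ℕ
walkBound a zero    = 0
walkBound a (suc n) = a * suc (walkBound a n)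

pathAvoiding : (H : Graph) (w : V H) {xs : List (V H)} →
               Linked (Adj H) xs → Unique xs → All (_≢ w) xs → HasPathAvoiding H w (length xs)
pathAvoiding H w {xs} linked unique avoids =
  lookup xs , (lookup-injective unique , Linked-lookup linked) , λ i → All.lookup avoids (∈-lookup i)

module _ (G H : Graph) (f : V G → V H) (quotient : IsHPartition G H f) (a : ℕ) where

  inPart : (x : V H) → Decidable (λ u → f u ≡ x)
  inPart x u = f u ≟ x

  Sparse : List (V G) → Set
  Sparse xs = ∀ x → count (inPart x) xs ≤ a

  Sparse-mono : ∀ {xs ys} → xs ⊑ ys → Sparse ys → Sparse xs
  Sparse-mono xs⊑ys sparse x = ≤-trans (count-mono (inPart x) xs⊑ys) (sparse x)

  path-sparse : ∀ {n} {p : Fin n → V G} → (∀ {i j} → p i ≡ p j → i ≡ j) →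
                (∀ x → partSize G H f x ≤ a) → Sparse (tabulate p)
  path-sparse {p = p} p-injective small x = ≤-trans
    (Unique-⊆⇒length-≤ (Unique.filter⁺ (inPart x) {tabulate p} (Unique.tabulate⁺ p-injective))
                       (filter⁺′ (inPart x) (inPart x) id {tabulate p} (λ _ → ∈-allFin _)))
    (small x)

  QuotientPath : ℕ → V G → List (V G) → Set
  QuotientPath n u t = ∃ λ π →
    length π ≡ n × Linked (Adj H) (f u ∷ π) × Unique (f u ∷ π) × f u ∷ π ⊆ map f (u ∷ t)

  walk⇒path : ∀ n {u t} → Linked (Adj G) (u ∷ t) → Sparse (u ∷ t) → walkBound a n ≤ length t →
              QuotientPath n u t
  walk⇒path zero _ _ _ = [] , refl , [-] , [] ∷ [] , λ { (here refl) → here refl }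
  walk⇒path (suc n) {u} {t} walk sparse len =
    extend (long-run-after (inPart (f u)) a t refl (sparse (f u)) len)
    where
    extend : MarkedRun (inPart (f u)) (walkBound a n) (u ∷ t) → QuotientPath (suc n) u t
    extend record { segment = [] ; long = () }
    extend record { before = pre ; marker = z ; segment = v ∷ s ; after = suf
                  ; split = split ; marked = fz≡fu ; avoids = avoids ; long = long } =
      prepend (walk⇒path n run-linked run-sparse (≤-pred long))
      where
      marked-linked : Linked (Adj G) (z ∷ v ∷ s)
      marked-linked = Linked-infix pre (z ∷ v ∷ s) (subst (Linked (Adj G)) split walk)
      run-linked : Linked (Adj G) (v ∷ s)
      run-linked = Linked.tail marked-linked
      run⊑walk : v ∷ s ⊑ u ∷ t
      run⊑walk = subst (v ∷ s ⊑_) (≡.sym split)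
        (Sublist.++⁺ˡ pre (z Sublist.∷ʳ Sublist.++⁺ʳ suf Sublist.⊆-refl))
      run-sparse : Sparse (v ∷ s)
      run-sparse = Sparse-mono run⊑walk sparse
      fu~fv : Adj H (f u) (f v)
      fu~fv = Equivalence.from (quotient (f u) (f v) (λ fu≡fv → All.head avoids (≡.sym fu≡fv)))
        (z , v , fz≡fu , refl , Linked.head marked-linked)
      fu∉run : All (f u ≢_) (map f (v ∷ s))
      fu∉run = All-map⁺ (All.map (λ fz≢fu fu≡fz → fz≢fu (≡.sym fu≡fz)) avoids)
      prepend : QuotientPath n v s → QuotientPath (suc n) u t
      prepend (π , |π|≡n , π-linked , π-unique , π⊆) =
        f v ∷ π , cong suc |π|≡n , fu~fv ∷ π-linked , All-resp-⊇ π⊆ fu∉run ∷ π-unique ,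
        ∈-∷⁺ʳ (here refl) (⊆-trans π⊆ (map⁺ f (Sublist.lookup run⊑walk)))

  long-path⇒avoiding-path : ∀ n w → (∀ x → partSize G H f x ≤ a) →
                            HasPath G (suc a * suc (walkBound a n)) → HasPathAvoiding H w (suc n)
  long-path⇒avoiding-path n w small (p , p-injective , p-adjacent) =
    from-run (long-run (inPart w) a (tabulate p) (path-sparse p-injective small w)
                       (≤-reflexive (≡.sym (length-tabulate p))))
    where
    from-run : Run (inPart w) (walkBound a n) (tabulate p) → HasPathAvoiding H w (suc n)
    from-run record { segment = [] ; long = () }
    from-run record { before = pre ; segment = v ∷ s ; after = suf
                    ; split = split ; avoids = avoids ; long = long } =
      finish (walk⇒path n run-linked (Sparse-mono run⊑path (path-sparse p-injective small)) (≤-pred long))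
      where
      run-linked : Linked (Adj G) (v ∷ s)
      run-linked = Linked-infix pre (v ∷ s) (subst (Linked (Adj G)) split (Linked-tabulate p-adjacent))
      run⊑path : v ∷ s ⊑ tabulate p
      run⊑path = subst (v ∷ s ⊑_) (≡.sym split) (Sublist.++⁺ˡ pre (Sublist.++⁺ʳ suf Sublist.⊆-refl))
      finish : QuotientPath n v s → HasPathAvoiding H w (suc n)
      finish (π , |π|≡n , π-linked , π-unique , π⊆) =
        subst (HasPathAvoiding H w) (cong suc |π|≡n)
              (pathAvoiding H w π-linked π-unique (All-resp-⊇ π⊆ (All-map⁺ avoids)))

lemma9 : (a n : ℕ) → Σ ℕ λ n′ →
    (G H : Graph) (f : V G → V H) → IsHPartition G H f →
    (∀ x → partSize G H f x ≤ a) → (w : V H) →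
    HasPath G n′ → HasPathAvoiding H w n
lemma9 a zero    = 0 , λ G H f _ _ w _ → pathAvoiding H w [] [] []
lemma9 a (suc n) = suc a * suc (walkBound a n) ,
  λ G H f quotient small w → long-path⇒avoiding-path G H f quotient a n w small
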